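{- For every positive integer $m\le 4356$, the Ruzsa number satisfies $R_m\le 132$.
   Context: For a positive integer $m$, let $\mathbb{Z}_m=\mathbb{Z}/m\mathbb{Z}$. For $A\subseteq \mathbb{Z}_m$ and $n\in\mathbb{Z}_m$, let $\sigma_A(n)$ denote the number of ordered pairs $(x,y)\in A\times A$ with $x+y=n$ in $\mathbb{Z}_m$. The Ruzsa number $R_m$ is the least positive integer $r$ such that there exists a set $A\subseteq\mathbb{Z}_m$ with $1\le \sigma_A(n)\le r$ for all $n\in\mathbb{Z}_m$. -}

module Defs where

open import Data.Nat using (ℕ; suc; _+_; _≤_; _%_)
open import Data.Nat.Properties using (_≟_)
open import Data.Fin using (Fin; toℕ)
open import Data.Fin.Subset using (Subset; _∈_)
open import Data.Fin.Subset.Properties using (_∈?_)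
open import Data.List using (List; length; filter; allFin; cartesianProduct)
open import Data.Product using (_×_; _,_; ∃-syntax)
open import Relation.Nullary using (Dec; _×-dec_)

-- ℤ_m for m = suc k is represented by Fin (suc k); x + y in ℤ_m is (x + y) mod m.

σ : ∀ {k} → Subset (suc k) → Fin (suc k) → ℕ
σ {k} A n = length (filter P? (cartesianProduct (allFin (suc k)) (allFin (suc k))))
  where
  P? : (p : Fin (suc k) × Fin (suc k)) → Dec _
  P? (x , y) = (x ∈? A) ×-dec ((y ∈? A) ×-dec (((toℕ x + toℕ y) % suc k) ≟ toℕ n))

Admissible : ℕ → ℕ → Set
Admissible k r = ∃[ A ] (∀ (n : Fin (suc k)) → 1 ≤ σ A n × σ A n ≤ r)

-- R_m is the least positive admissible r; "R_m ≤ r" (m = suc k) means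
-- some positive r' ≤ r is admissible (then the least one is ≤ r' ≤ r).
RuzsaLe : ℕ → ℕ → Set
RuzsaLe k r = ∃[ r' ] (1 ≤ r' × r' ≤ r × Admissible k r')

-- Take A = {0, …, 65} ∪ 66ℤ inside ℤ_m.  Every residue n < m is n mod 66 + 66 ⌊n / 66⌋, a
-- sum of two elements of A without wrap-around, so σ_A(n) ≥ 1.  Conversely, in a pair
-- (x , y) counted by σ_A(n) the element y is determined by x, so σ_A(n) ≤ |A|; and for
-- m ≤ 66² = 4356 the set A has at most 66 + 65 = 131 elements.
module Submission where

open import Defs
open import Data.Nat using (ℕ; zero; suc; _+_; _*_; _∸_; _%_; _/_; _≤_; _<_; z≤n; s≤s; _<?_; NonZero)
open import Data.Nat.Properties
open import Data.Nat.DivMod using (m≡m%n+[m/n]*n; m%n<n; m%n≤m; m<n⇒m%n≡m; [m+n]%n≡m%n; %-distribˡ-+; m%n%n≡m%n)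
open import Data.Nat.Divisibility using (_∣_; _∣?_; n∣m*n)
open import Data.Fin using (Fin; toℕ; fromℕ<)
open import Data.Fin.Properties using (toℕ-injective; toℕ<n; toℕ-fromℕ<)
import Data.Fin.Properties as Finₚ
open import Data.Fin.Subset using (Subset; _∈_)
open import Data.Fin.Subset.Properties using (_∈?_)
open import Data.List using ([]; _∷_; [_]; _++_; length; filter; map; tabulate; allFin; cartesianProduct; applyUpTo; upTo; _∷ʳ_)
open import Data.List.Properties using (filter-++; length-++; filter-none; filter-some; filter-≐; map-tabulate; upTo-∷ʳ)
open import Data.List.Membership.Propositional using (lose)
open import Data.List.Membership.Propositional.Properties using (∈-cartesianProduct⁺; ∈-allFin)
open import Data.List.Relation.Unary.All.Properties using (tabulate⁺)
open import Data.Bool using (true; false)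
open import Data.Product using (_×_; _,_)
open import Data.Sum using (_⊎_; inj₁; inj₂)
import Data.Vec as Vec
open import Data.Vec.Properties using (lookup∘tabulate; lookup⇒[]=; []=⇒lookup)
open import Function using (_∘_)
open import Relation.Nullary using (yes; no; does; ¬_; _×-dec_)
open import Relation.Nullary.Decidable using (_⊎-dec_; dec-true)
open import Relation.Unary using (Pred; Decidable)
open import Relation.Binary.PropositionalEquality using (_≡_; refl; sym; trans; cong; cong₂; subst; module ≡-Reasoning)

module _ {a p} {X : Set a} {P : Pred X p} (P? : Decidable P) where

  length-filter-++ : ∀ xs ys → length (filter P? (xs ++ ys)) ≡ length (filter P? xs) + length (filter P? ys)
  length-filter-++ xs ys = trans (cong length (filter-++ P? xs ys)) (length-++ (filter P? xs))

  length-filter-tabulate-≤1 : ∀ {n} (f : Fin n → X) → (∀ i j → P (f i) → P (f j) → i ≡ j) →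
                              length (filter P? (tabulate f)) ≤ 1
  length-filter-tabulate-≤1 {zero}  f unique = z≤n
  length-filter-tabulate-≤1 {suc n} f unique with P? (f Fin.zero)
  ... | yes p₀ = s≤s (≤-reflexive (cong length (filter-none P? (tabulate⁺ {f = f ∘ Fin.suc} ¬p₊))))
    where
    ¬p₊ : ∀ i → ¬ P (f (Fin.suc i))
    ¬p₊ i pᵢ with () ← unique _ _ p₀ pᵢ
  ... | no _ = length-filter-tabulate-≤1 (f ∘ Fin.suc) λ i j pᵢ pⱼ → Finₚ.suc-injective (unique _ _ pᵢ pⱼ)

module _ {a b p q} {X : Set a} {Y : Set b} {P : Pred (X × Y) p} (P? : Decidable P)
         {Q : Pred X q} (Q? : Decidable Q) where

  length-filter-cartesianProduct-≤ : ∀ xs ys →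
    (∀ x → length (filter P? (map (x ,_) ys)) ≤ 1) →
    (∀ {x} → ¬ Q x → length (filter P? (map (x ,_) ys)) ≡ 0) →
    length (filter P? (cartesianProduct xs ys)) ≤ length (filter Q? xs)
  length-filter-cartesianProduct-≤ []       ys ≤1 ≡0 = z≤n
  length-filter-cartesianProduct-≤ (x ∷ xs) ys ≤1 ≡0 = begin
    length (filter P? (map (x ,_) ys ++ cartesianProduct xs ys))
      ≡⟨ length-filter-++ P? (map (x ,_) ys) (cartesianProduct xs ys) ⟩
    length (filter P? (map (x ,_) ys)) + length (filter P? (cartesianProduct xs ys))
      ≤⟨ +-mono-≤ row (length-filter-cartesianProduct-≤ xs ys ≤1 ≡0) ⟩
    length (filter Q? [ x ]) + length (filter Q? xs)
      ≡⟨ length-filter-++ Q? [ x ] xs ⟨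
    length (filter Q? (x ∷ xs))
      ∎
    where
    open ≤-Reasoning
    row : length (filter P? (map (x ,_) ys)) ≤ length (filter Q? [ x ])
    row with Q? x
    ... | yes _  = ≤1 x
    ... | no ¬qx = ≤-reflexive (≡0 ¬qx)

module _ {p} {P : Pred ℕ p} (P? : Decidable P) where

  length-filter-upTo-mono : ∀ {m n} → m ≤ n → length (filter P? (upTo m)) ≤ length (filter P? (upTo n))
  length-filter-upTo-mono {n = zero} z≤n = ≤-refl
  length-filter-upTo-mono {m} {suc n} m≤1+n with m≤n⇒m<n∨m≡n m≤1+n
  ... | inj₂ refl = ≤-refl
  ... | inj₁ (s≤s m≤n) = begin
    length (filter P? (upTo m))                                   ≤⟨ length-filter-upTo-mono m≤n ⟩
    length (filter P? (upTo n))                                   ≤⟨ m≤m+n _ _ ⟩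
    length (filter P? (upTo n)) + length (filter P? [ n ])        ≡⟨ length-filter-++ P? (upTo n) [ n ] ⟨
    length (filter P? (upTo n ∷ʳ n))                              ≡⟨ cong (length ∘ filter P?) (upTo-∷ʳ n) ⟩
    length (filter P? (upTo (suc n)))                             ∎
    where open ≤-Reasoning

length-filter-∘ : ∀ {a b p} {X : Set a} {Y : Set b} {P : Pred Y p} (P? : Decidable P) (f : X → Y) xs →
                  length (filter (P? ∘ f) xs) ≡ length (filter P? (map f xs))
length-filter-∘ P? f [] = refl
length-filter-∘ P? f (x ∷ xs) with does (P? (f x))
... | true  = cong suc (length-filter-∘ P? f xs)
... | false = length-filter-∘ P? f xs

tabulate-toℕ : ∀ {a} {X : Set a} n (f : ℕ → X) → tabulate {n = n} (f ∘ toℕ) ≡ applyUpTo f n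
tabulate-toℕ zero    f = refl
tabulate-toℕ (suc n) f = cong (f 0 ∷_) (tabulate-toℕ n (f ∘ suc))

map-toℕ-allFin : ∀ n → map toℕ (allFin n) ≡ upTo n
map-toℕ-allFin n = trans (map-tabulate (λ i → i) toℕ) (tabulate-toℕ n (λ i → i))

[m+n]%o≡[m+p]%o⇒n%o≡p%o : ∀ {m n p o} .{{_ : NonZero o}} → m ≤ o →
                          (m + n) % o ≡ (m + p) % o → n % o ≡ p % o
[m+n]%o≡[m+p]%o⇒n%o≡p%o {m} {n} {p} {o} m≤o eq = begin
  n % o                          ≡⟨ unshift n ⟨
  (o ∸ m + (m + n) % o) % o      ≡⟨ cong (λ r → (o ∸ m + r) % o) eq ⟩
  (o ∸ m + (m + p) % o) % o      ≡⟨ unshift p ⟩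
  p % o                          ∎
  where
  open ≡-Reasoning
  -- adding o ∸ m undoes the translation by m, since (o ∸ m) + m = o
  unshift : ∀ k → (o ∸ m + (m + k) % o) % o ≡ k % o
  unshift k = begin
    (o ∸ m + (m + k) % o) % o            ≡⟨ %-distribˡ-+ (o ∸ m) ((m + k) % o) o ⟩
    ((o ∸ m) % o + (m + k) % o % o) % o  ≡⟨ cong (λ r → ((o ∸ m) % o + r) % o) (m%n%n≡m%n (m + k) o) ⟩
    ((o ∸ m) % o + (m + k) % o) % o      ≡⟨ %-distribˡ-+ (o ∸ m) (m + k) o ⟨
    (o ∸ m + (m + k)) % o                ≡⟨ cong (_% o) (+-assoc (o ∸ m) m k) ⟨
    (o ∸ m + m + k) % o                  ≡⟨ cong (λ r → (r + k) % o) (m∸n+n≡m m≤o) ⟩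
    (o + k) % o                          ≡⟨ cong (_% o) (+-comm o k) ⟩
    (k + o) % o                          ≡⟨ [m+n]%n≡m%n k o ⟩
    k % o                                ∎

size : ∀ {n} → Subset n → ℕ
size {n} A = length (filter (_∈? A) (allFin n))

module _ {k : ℕ} where

  private
    m = suc k

  -- σ A n is, by definition, the number of pairs in allFin m × allFin m satisfying sumsTo? A n.
  SumsTo : Subset m → Fin m → Pred (Fin m × Fin m) _
  SumsTo A n (x , y) = x ∈ A × y ∈ A × (toℕ x + toℕ y) % m ≡ toℕ n

  sumsTo? : ∀ A n → Decidable (SumsTo A n)
  sumsTo? A n (x , y) = (x ∈? A) ×-dec ((y ∈? A) ×-dec (((toℕ x + toℕ y) % m) ≟ toℕ n))

  σ-positive : ∀ {A n x y} → x ∈ A → y ∈ A → (toℕ x + toℕ y) % m ≡ toℕ n → 1 ≤ σ A n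
  σ-positive {A} {n} {x} {y} x∈A y∈A x+y≡n =
    filter-some (sumsTo? A n) (lose (∈-cartesianProduct⁺ (∈-allFin x) (∈-allFin y)) (x∈A , y∈A , x+y≡n))

  σ≤size : ∀ A n → σ A n ≤ size A
  σ≤size A n = length-filter-cartesianProduct-≤ (sumsTo? A n) (_∈? A) (allFin m) (allFin m)
    (λ x → subst (λ ys → length (filter (sumsTo? A n) ys) ≤ 1) (sym (map-tabulate (λ i → i) (x ,_))) (row≤1 x))
    (λ {x} x∉A → subst (λ ys → length (filter (sumsTo? A n) ys) ≡ 0) (sym (map-tabulate (λ i → i) (x ,_)))
                       (cong length (filter-none (sumsTo? A n) (tabulate⁺ {f = x ,_} λ i (x∈A , _) → x∉A x∈A))))
    where
    row≤1 : ∀ x → length (filter (sumsTo? A n) (tabulate (x ,_))) ≤ 1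
    row≤1 x = length-filter-tabulate-≤1 (sumsTo? A n) (x ,_) λ i j (_ , _ , x+i≡n) (_ , _ , x+j≡n) →
      toℕ-injective (begin
        toℕ i      ≡⟨ m<n⇒m%n≡m (toℕ<n i) ⟨
        toℕ i % m  ≡⟨ [m+n]%o≡[m+p]%o⇒n%o≡p%o (<⇒≤ (toℕ<n x)) (trans x+i≡n (sym x+j≡n)) ⟩
        toℕ j % m  ≡⟨ m<n⇒m%n≡m (toℕ<n j) ⟩
        toℕ j      ∎)
      where open ≡-Reasoning

module _ {n p} {P : Pred (Fin n) p} (P? : Decidable P) where

  subset : Subset n
  subset = Vec.tabulate (does ∘ P?)

  ∈-subset⁺ : ∀ {x} → P x → x ∈ subset
  ∈-subset⁺ {x} px = lookup⇒[]= x subset (trans (lookup∘tabulate (does ∘ P?) x) (dec-true (P? x) px))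

  ∈-subset⁻ : ∀ {x} → x ∈ subset → P x
  ∈-subset⁻ {x} x∈ with P? x | trans (sym (lookup∘tabulate (does ∘ P?) x)) ([]=⇒lookup x∈)
  ... | yes px | _ = px
  ... | no _   | ()

  size-subset : size subset ≡ length (filter P? (allFin n))
  size-subset = cong length (filter-≐ (_∈? subset) P? (∈-subset⁻ , ∈-subset⁺) (allFin n))

LowOrMultiple : ℕ → Pred ℕ _
LowOrMultiple b i = i < b ⊎ b ∣ i

lowOrMultiple? : ∀ b → Decidable (LowOrMultiple b)
lowOrMultiple? b i = (i <? b) ⊎-dec (b ∣? i)

lowOrMultiples : ∀ b {n} → Subset n
lowOrMultiples b = subset (lowOrMultiple? b ∘ toℕ)

size-lowOrMultiples : ∀ b n → size (lowOrMultiples b {n}) ≡ length (filter (lowOrMultiple? b) (upTo n))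
size-lowOrMultiples b n = begin
  size (lowOrMultiples b {n})                            ≡⟨ size-subset {n = n} (lowOrMultiple? b ∘ toℕ) ⟩
  length (filter (lowOrMultiple? b ∘ toℕ) (allFin n))    ≡⟨ length-filter-∘ (lowOrMultiple? b) toℕ (allFin n) ⟩
  length (filter (lowOrMultiple? b) (map toℕ (allFin n))) ≡⟨ cong (length ∘ filter (lowOrMultiple? b)) (map-toℕ-allFin n) ⟩
  length (filter (lowOrMultiple? b) (upTo n))            ∎
  where open ≡-Reasoning

σ-lowOrMultiples-positive : ∀ b .{{_ : NonZero b}} {k} n → 1 ≤ σ (lowOrMultiples b {suc k}) n
σ-lowOrMultiples-positive b {k} n =
  σ-positive (∈-subset⁺ (lowOrMultiple? b ∘ toℕ) {x} (inj₁ x<b)) (∈-subset⁺ (lowOrMultiple? b ∘ toℕ) {y} (inj₂ b∣y)) x+y≡n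
  where
  N = toℕ n
  N≡r+q : N ≡ N % b + (N / b) * b
  N≡r+q = m≡m%n+[m/n]*n N b
  r<m : N % b < suc k
  r<m = ≤-<-trans (m%n≤m N b) (toℕ<n n)
  q<m : (N / b) * b < suc k
  q<m = ≤-<-trans (m≤n+m _ (N % b)) (subst (_< suc k) N≡r+q (toℕ<n n))
  x y : Fin (suc k)
  x = fromℕ< r<m
  y = fromℕ< q<m
  x<b : toℕ x < b
  x<b = subst (_< b) (sym (toℕ-fromℕ< r<m)) (m%n<n N b)
  b∣y : b ∣ toℕ y
  b∣y = subst (b ∣_) (sym (toℕ-fromℕ< q<m)) (n∣m*n (N / b))
  x+y≡n : (toℕ x + toℕ y) % suc k ≡ N
  x+y≡n = begin
    (toℕ x + toℕ y) % suc k          ≡⟨ cong₂ (λ u v → (u + v) % suc k) (toℕ-fromℕ< r<m) (toℕ-fromℕ< q<m) ⟩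
    (N % b + (N / b) * b) % suc k    ≡⟨ cong (_% suc k) N≡r+q ⟨
    N % suc k                        ≡⟨ m<n⇒m%n≡m (toℕ<n n) ⟩
    N                                ∎
    where open ≡-Reasoning

lemma2 : (k : ℕ) → suc k ≤ 4356 → RuzsaLe k 132
lemma2 k m≤4356 = 131 , s≤s z≤n , n≤1+n 131 , A , λ n → σ-lowOrMultiples-positive 66 n , σ≤131 n
  where
  A : Subset (suc k)
  A = lowOrMultiples 66
  σ≤131 : ∀ n → σ A n ≤ 131
  σ≤131 n = begin
    σ A n                                                   ≤⟨ σ≤size A n ⟩
    size A                                                  ≡⟨ size-lowOrMultiples 66 (suc k) ⟩
    length (filter (lowOrMultiple? 66) (upTo (suc k)))      ≤⟨ length-filter-upTo-mono (lowOrMultiple? 66) m≤4356 ⟩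
    length (filter (lowOrMultiple? 66) (upTo 4356))         ≡⟨⟩
    131                                                     ∎
    where open ≤-Reasoning
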